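{- Let $f \ge 0$, $s \ge 0$ be integers with $f+s=\ell$, let $G$ be a directed graph, and let $r \in V(G)$. If $G$ contains a set $F$ of $(2\ell-1)$-extenders for $r$ with $|F| = f$, and a $(2,s)$-spider $S$ rooted at $r$ with $V(S) \cap F = \emptyset$, then $G$ contains a $(2,\ell)$-spider rooted at $r$.
   Context: A directed graph is finite, has no loops, and may contain both edges $(x,y)$ and $(y,x)$. Write $x \to y \to z$ to mean that $(x,y)$ and $(y,z)$ are edges of $G$ and $x \ne z$. For a vertex $r$ and a vertex $x \ne r$, let $O_{x,r} = \{ y \in V(G) : (x \to y \to r) \text{ or } (y \to x \to r)\}$. For an integer $i \ge 1$, a vertex $x \ne r$ is an $i$-extender for $r$ if $|O_{x,r}| \ge i$. A $(2,s)$-spider rooted at $r$ is a subgraph consisting of $r$ together with $s$ directed paths $x_j \to y_j \to r$ ($1 \le j \le s$) on $2s+1$ pairwise distinct vertices; for $s=0$ it is the single vertex $r$. -}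

module Defs where

open import Data.Nat using (ℕ; _+_; _*_; _∸_; _≥_)
open import Data.Bool using (Bool; true; false; _∧_; _∨_; not)
open import Data.Fin using (Fin; _≟_)
open import Data.Fin.Subset using (Subset; _∈_; _∉_; ∣_∣)
open import Data.Vec using (tabulate)
open import Relation.Nullary using (does; ¬_)
open import Relation.Binary.PropositionalEquality using (_≡_; _≢_)

record Digraph : Set where
  field
    n      : ℕ
    edge   : Fin n → Fin n → Bool
    noLoop : ∀ x → edge x x ≡ false

open Digraph public

path2? : (G : Digraph) → Fin (n G) → Fin (n G) → Fin (n G) → Bool
path2? G x y z = edge G x y ∧ edge G y z ∧ not (does (x ≟ z))

O : (G : Digraph) → Fin (n G) → Fin (n G) → Subset (n G)
O G x r = tabulate (λ y → path2? G x y r ∨ path2? G y x r)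

IsExtender : (G : Digraph) → ℕ → Fin (n G) → Fin (n G) → Set
IsExtender G i x r = (x ≢ r) × (∣ O G x r ∣ ≥ i)
  where open import Data.Product using (_×_)

record Spider (G : Digraph) (s : ℕ) (r : Fin (n G)) : Set where
  field
    xs ys   : Fin s → Fin (n G)
    edgeXY  : ∀ j → edge G (xs j) (ys j) ≡ true
    edgeYR  : ∀ j → edge G (ys j) r ≡ true
    xs-inj  : ∀ i j → xs i ≡ xs j → i ≡ j
    ys-inj  : ∀ i j → ys i ≡ ys j → i ≡ j
    xs≢ys   : ∀ i j → xs i ≢ ys j
    xs≢r    : ∀ j → xs j ≢ r
    ys≢r    : ∀ j → ys j ≢ r

open Spider public

DisjointFrom : {G : Digraph} {s : ℕ} {r : Fin (n G)} → Spider G s r → Subset (n G) → Set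
DisjointFrom {r = r} S F = (r ∉ F) × (∀ j → xs S j ∉ F) × (∀ j → ys S j ∉ F)
  where open import Data.Product using (_×_)

-- Take an extender x ∈ F: the forbidden vertices, namely the rest of F and the
-- 2s non-root vertices of the spider, number f - 1 + 2s < 2ℓ - 1 ≤ |O_{x,r}|, so some y ∈ O_{x,r}
-- is not forbidden. One of x → y → r, y → x → r is a new leg, turning F, S into F - x and a
-- (2, s+1)-spider that still avoids it.
module Submission where

open import Defs
open import Data.Nat using (ℕ; _+_; _*_; _∸_; zero; suc; _≤_; _<_; z≤n; s≤s)
open import Data.Nat.Properties using (≤-trans; ≤-reflexive; n≤1+n; m≤m+n; +-suc; +-mono-≤; +-monoʳ-≤; <⇒≱; suc-injective)
open import Data.Nat.Solver using (module +-*-Solver)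
open import Data.Bool using (true; false)
open import Data.Fin using (Fin; zero; suc; _≟_)
open import Data.Fin.Properties using (¬∀⟶∃¬)
open import Data.Fin.Subset using (Subset; _∈_; _∉_; ∣_∣; _∪_; _-_; ⁅_⁆; ⊥; _⊆_; inside; outside)
open import Data.Fin.Subset.Properties using (_∈?_; ∉⊥; x∈p∪q⁺; x∈p∪q⁻; x∈⁅x⁆; x∈⁅y⁆⇒x≡y; ∣⊥∣≡0; ∣⁅x⁆∣≡1; p─⊥≡p; p─q⊆p; p⊆q⇒∣p∣≤∣q∣)
open import Data.Vec using ([]; _∷_; here; there)
open import Data.Vec.Properties using ([]=⇒lookup; lookup∘tabulate)
import Data.Vec.Functional as Vector
open import Data.Product using (_×_; Σ-syntax; ∃; _,_; proj₁; proj₂)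
open import Data.Sum using (_⊎_; inj₁; inj₂)
open import Data.Empty using (⊥-elim)
open import Function using (_∘_)
open import Relation.Nullary using (yes; no)
open import Relation.Nullary.Decidable using (_→-dec_)
open import Relation.Binary.PropositionalEquality using (_≡_; _≢_; refl; sym; trans; cong; subst)

private
  variable
    m s : ℕ

∣p∪q∣≤∣p∣+∣q∣ : (p q : Subset m) → ∣ p ∪ q ∣ ≤ ∣ p ∣ + ∣ q ∣
∣p∪q∣≤∣p∣+∣q∣ [] [] = z≤n
∣p∪q∣≤∣p∣+∣q∣ (inside ∷ p) (inside ∷ q) =
  s≤s (≤-trans (∣p∪q∣≤∣p∣+∣q∣ p q) (≤-trans (n≤1+n _) (≤-reflexive (sym (+-suc _ _)))))
∣p∪q∣≤∣p∣+∣q∣ (inside ∷ p) (outside ∷ q) = s≤s (∣p∪q∣≤∣p∣+∣q∣ p q)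
∣p∪q∣≤∣p∣+∣q∣ (outside ∷ p) (inside ∷ q) =
  ≤-trans (s≤s (∣p∪q∣≤∣p∣+∣q∣ p q)) (≤-reflexive (sym (+-suc _ _)))
∣p∪q∣≤∣p∣+∣q∣ (outside ∷ p) (outside ∷ q) = ∣p∪q∣≤∣p∣+∣q∣ p q

x∉p∪q⇒x∉p : {x : Fin m} {p q : Subset m} → x ∉ p ∪ q → x ∉ p
x∉p∪q⇒x∉p x∉p∪q = x∉p∪q ∘ x∈p∪q⁺ ∘ inj₁

x∉p∪q⇒x∉q : {x : Fin m} {p q : Subset m} → x ∉ p ∪ q → x ∉ q
x∉p∪q⇒x∉q x∉p∪q = x∉p∪q ∘ x∈p∪q⁺ ∘ inj₂

∣p∣≡1+k⇒nonempty : {k : ℕ} (p : Subset m) → ∣ p ∣ ≡ suc k → ∃ λ x → x ∈ p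
∣p∣≡1+k⇒nonempty (inside ∷ p) _ = zero , here
∣p∣≡1+k⇒nonempty (outside ∷ p) ∣p∣≡1+k with ∣p∣≡1+k⇒nonempty p ∣p∣≡1+k
... | x , x∈p = suc x , there x∈p

x∈p⇒1+∣p-x∣≡∣p∣ : (p : Subset m) (x : Fin m) → x ∈ p → suc ∣ p - x ∣ ≡ ∣ p ∣
x∈p⇒1+∣p-x∣≡∣p∣ (inside ∷ p) zero here = cong (suc ∘ ∣_∣) (p─⊥≡p p)
x∈p⇒1+∣p-x∣≡∣p∣ (inside ∷ p) (suc x) (there x∈p) = cong suc (x∈p⇒1+∣p-x∣≡∣p∣ p x x∈p)
x∈p⇒1+∣p-x∣≡∣p∣ (outside ∷ p) (suc x) (there x∈p) = x∈p⇒1+∣p-x∣≡∣p∣ p x x∈p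

x∉p-x : (p : Subset m) (x : Fin m) → x ∉ p - x
x∉p-x (_ ∷ p) (suc x) (there x∈p-x) = x∉p-x p x x∈p-x

∣q∣<∣p∣⇒∃∈p∉q : {p q : Subset m} → ∣ q ∣ < ∣ p ∣ → ∃ λ y → y ∈ p × y ∉ q
∣q∣<∣p∣⇒∃∈p∉q {m} {p} {q} ∣q∣<∣p∣
  with ¬∀⟶∃¬ m (λ y → y ∈ p → y ∈ q) (λ y → (y ∈? p) →-dec (y ∈? q))
         (λ p⊆q → <⇒≱ ∣q∣<∣p∣ (p⊆q⇒∣p∣≤∣q∣ (p⊆q _)))
... | y , y∈p↛y∈q with y ∈? p
...   | yes y∈p = y , y∈p , (λ y∈q → y∈p↛y∈q (λ _ → y∈q))
...   | no y∉p = ⊥-elim (y∈p↛y∈q (⊥-elim ∘ y∉p))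

image : (Fin s → Fin m) → Subset m
image {zero} g = ⊥
image {suc s} g = ⁅ g zero ⁆ ∪ image (g ∘ suc)

∣image∣≤ : (g : Fin s → Fin m) → ∣ image g ∣ ≤ s
∣image∣≤ {zero} {m} g = ≤-reflexive (∣⊥∣≡0 m)
∣image∣≤ {suc s} g = ≤-trans (∣p∪q∣≤∣p∣+∣q∣ ⁅ g zero ⁆ (image (g ∘ suc)))
  (subst (λ k → k + ∣ image (g ∘ suc) ∣ ≤ suc s) (sym (∣⁅x⁆∣≡1 (g zero))) (s≤s (∣image∣≤ (g ∘ suc))))

∈image : (g : Fin s → Fin m) (j : Fin s) → g j ∈ image g
∈image g zero = x∈p∪q⁺ (inj₁ (x∈⁅x⁆ (g zero)))
∈image g (suc j) = x∈p∪q⁺ (inj₂ (∈image (g ∘ suc) j))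

∈image⇒ : {v : Fin m} (g : Fin s → Fin m) → v ∈ image g → ∃ λ j → g j ≡ v
∈image⇒ {s = zero} g v∈⊥ = ⊥-elim (∉⊥ v∈⊥)
∈image⇒ {s = suc s} g v∈ with x∈p∪q⁻ ⁅ g zero ⁆ (image (g ∘ suc)) v∈
... | inj₁ v∈⁅g0⁆ = zero , sym (x∈⁅y⁆⇒x≡y (g zero) v∈⁅g0⁆)
... | inj₂ v∈image with ∈image⇒ (g ∘ suc) v∈image
...   | j , gj≡v = suc j , gj≡v

∉image : {v : Fin m} (g : Fin s → Fin m) → v ∉ image g → ∀ j → v ≢ g j
∉image g v∉ j refl = v∉ (∈image g j)

module _ {G : Digraph} where

  edge⇒≢ : {a b : Fin (n G)} → edge G a b ≡ true → a ≢ b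
  edge⇒≢ {a} a→b refl with trans (sym a→b) (noLoop G a)
  ... | ()

  path2?⇒ : (x y z : Fin (n G)) → path2? G x y z ≡ true →
            edge G x y ≡ true × edge G y z ≡ true × x ≢ z
  path2?⇒ x y z p with edge G x y | edge G y z | x ≟ z
  path2?⇒ x y z refl | true | true | no x≢z = refl , refl , x≢z
  path2?⇒ x y z () | true | true | yes _
  path2?⇒ x y z () | true | false | _
  path2?⇒ x y z () | false | _ | _

  ∈O⇒path2? : {x y r : Fin (n G)} → y ∈ O G x r → path2? G x y r ≡ true ⊎ path2? G y x r ≡ true
  ∈O⇒path2? {x} {y} {r} y∈O
    with path2? G x y r | trans (sym (lookup∘tabulate _ y)) ([]=⇒lookup y∈O)
  ... | true | _ = inj₁ refl
  ... | false | y→x→r = inj₂ y→x→r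

  module _ {r : Fin (n G)} where

    record Leg : Set where
      field
        outer inner : Fin (n G)
        outer→inner : edge G outer inner ≡ true
        inner→r     : edge G inner r ≡ true
        outer≢r     : outer ≢ r

    open Leg

    inner≢r : (P : Leg) → inner P ≢ r
    inner≢r P = edge⇒≢ (inner→r P)

    Avoids : Leg → Subset (n G) → Set
    Avoids P A = outer P ∉ A × inner P ∉ A

    ∈O⇒leg : {x y : Fin (n G)} {A : Subset (n G)} → x ≢ r → y ∈ O G x r → x ∉ A → y ∉ A →
             Σ[ P ∈ Leg ] Avoids P A
    ∈O⇒leg {x} {y} x≢r y∈O x∉A y∉A with ∈O⇒path2? y∈O
    ... | inj₁ x→y→r with path2?⇒ x y r x→y→r
    ...   | x→y , y→r , _ = record { outer = x ; inner = y ; outer→inner = x→y ; inner→r = y→r ; outer≢r = x≢r }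
                          , x∉A , y∉A
    ∈O⇒leg {x} {y} x≢r y∈O x∉A y∉A | inj₂ y→x→r with path2?⇒ y x r y→x→r
    ...   | y→x , x→r , y≢r = record { outer = y ; inner = x ; outer→inner = y→x ; inner→r = x→r ; outer≢r = y≢r }
                            , y∉A , x∉A

    legVertices : Spider G s r → Subset (n G)
    legVertices S = image (xs S) ∪ image (ys S)

    ∣legVertices∣≤2s : (S : Spider G s r) → ∣ legVertices S ∣ ≤ 2 * s
    ∣legVertices∣≤2s {s} S = ≤-trans (∣p∪q∣≤∣p∣+∣q∣ (image (xs S)) (image (ys S)))
      (+-mono-≤ (∣image∣≤ (xs S)) (≤-trans (∣image∣≤ (ys S)) (m≤m+n s 0)))

    disjoint⇒∉legVertices : {F : Subset (n G)} {x : Fin (n G)} (S : Spider G s r) →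
                            DisjointFrom S F → x ∈ F → x ∉ legVertices S
    disjoint⇒∉legVertices {F = F} S (_ , xs∉F , ys∉F) x∈F x∈legs
      with x∈p∪q⁻ (image (xs S)) (image (ys S)) x∈legs
    ... | inj₁ x∈xs with ∈image⇒ (xs S) x∈xs
    ...   | j , refl = xs∉F j x∈F
    disjoint⇒∉legVertices S (_ , xs∉F , ys∉F) x∈F x∈legs | inj₂ x∈ys with ∈image⇒ (ys S) x∈ys
    ...   | j , refl = ys∉F j x∈F

    addLeg : (P : Leg) (S : Spider G s r) → Avoids P (legVertices S) → Spider G (suc s) r
    addLeg P S (outer∉ , inner∉) = record
      { xs = X ; ys = Y ; edgeXY = X→Y ; edgeYR = Y→r ; xs-inj = X-inj ; ys-inj = Y-inj
      ; xs≢ys = X≢Y ; xs≢r = X≢r ; ys≢r = Y≢r }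
      where
      X Y : Fin (suc _) → Fin (n G)
      X = outer P Vector.∷ xs S
      Y = inner P Vector.∷ ys S

      outer≢xs = ∉image (xs S) (x∉p∪q⇒x∉p outer∉)
      outer≢ys = ∉image (ys S) (x∉p∪q⇒x∉q outer∉)
      inner≢xs = ∉image (xs S) (x∉p∪q⇒x∉p inner∉)
      inner≢ys = ∉image (ys S) (x∉p∪q⇒x∉q inner∉)

      X→Y : ∀ j → edge G (X j) (Y j) ≡ true
      X→Y zero = outer→inner P
      X→Y (suc j) = edgeXY S j
      Y→r : ∀ j → edge G (Y j) r ≡ true
      Y→r zero = inner→r P
      Y→r (suc j) = edgeYR S j
      X-inj : ∀ i j → X i ≡ X j → i ≡ j
      X-inj zero zero _ = refl
      X-inj zero (suc j) e = ⊥-elim (outer≢xs j e)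
      X-inj (suc i) zero e = ⊥-elim (outer≢xs i (sym e))
      X-inj (suc i) (suc j) e = cong suc (xs-inj S i j e)
      Y-inj : ∀ i j → Y i ≡ Y j → i ≡ j
      Y-inj zero zero _ = refl
      Y-inj zero (suc j) e = ⊥-elim (inner≢ys j e)
      Y-inj (suc i) zero e = ⊥-elim (inner≢ys i (sym e))
      Y-inj (suc i) (suc j) e = cong suc (ys-inj S i j e)
      X≢Y : ∀ i j → X i ≢ Y j
      X≢Y zero zero = edge⇒≢ (outer→inner P)
      X≢Y zero (suc j) = outer≢ys j
      X≢Y (suc i) zero = inner≢xs i ∘ sym
      X≢Y (suc i) (suc j) = xs≢ys S i j
      X≢r : ∀ j → X j ≢ r
      X≢r zero = outer≢r P
      X≢r (suc j) = xs≢r S j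
      Y≢r : ∀ j → Y j ≢ r
      Y≢r zero = inner≢r P
      Y≢r (suc j) = ys≢r S j

    addLeg-disjoint : {B : Subset (n G)} (P : Leg) (S : Spider G s r) (av : Avoids P (legVertices S)) →
                      DisjointFrom S B → Avoids P B → DisjointFrom (addLeg P S av) B
    addLeg-disjoint P S av (r∉B , xs∉B , ys∉B) (outer∉B , inner∉B) = r∉B , X∉B , Y∉B
      where
      X∉B : ∀ j → _
      X∉B zero = outer∉B
      X∉B (suc j) = xs∉B j
      Y∉B : ∀ j → _
      Y∉B zero = inner∉B
      Y∉B (suc j) = ys∉B j

    disjoint-⊆ : {A B : Subset (n G)} (S : Spider G s r) → A ⊆ B → DisjointFrom S B → DisjointFrom S A
    disjoint-⊆ S A⊆B (r∉B , xs∉B , ys∉B) = r∉B ∘ A⊆B , (λ j → xs∉B j ∘ A⊆B) , (λ j → ys∉B j ∘ A⊆B)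

    leg-avoiding : {x : Fin (n G)} {A : Subset (n G)} → x ≢ r → x ∉ A → ∣ A ∣ < ∣ O G x r ∣ →
                   Σ[ P ∈ Leg ] Avoids P A
    leg-avoiding x≢r x∉A ∣A∣<∣O∣ with ∣q∣<∣p∣⇒∃∈p∉q ∣A∣<∣O∣
    ... | y , y∈O , y∉A = ∈O⇒leg x≢r y∈O x∉A y∉A

    avoids-∪ : {A B : Subset (n G)} (P : Leg) → Avoids P (A ∪ B) → Avoids P A × Avoids P B
    avoids-∪ P (outer∉ , inner∉) = (x∉p∪q⇒x∉p outer∉ , x∉p∪q⇒x∉p inner∉) , (x∉p∪q⇒x∉q outer∉ , x∉p∪q⇒x∉q inner∉)

    extendSpider : {i : ℕ} {F : Subset (n G)} {x : Fin (n G)} → x ∈ F → IsExtender G i x r →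
                   ∣ F - x ∣ + 2 * s < i → (S : Spider G s r) → DisjointFrom S F →
                   Σ[ S′ ∈ Spider G (suc s) r ] DisjointFrom S′ (F - x)
    extendSpider {s} {i} {F} {x} x∈F (x≢r , ∣O∣≥i) bound S S∩F=∅
      with leg-avoiding {A = (F - x) ∪ legVertices S} x≢r x∉forbidden ∣forbidden∣<∣O∣
      where
      x∉forbidden : x ∉ (F - x) ∪ legVertices S
      x∉forbidden x∈ with x∈p∪q⁻ (F - x) (legVertices S) x∈
      ... | inj₁ x∈F-x = x∉p-x F x x∈F-x
      ... | inj₂ x∈legs = disjoint⇒∉legVertices S S∩F=∅ x∈F x∈legs
      ∣forbidden∣<∣O∣ : ∣ (F - x) ∪ legVertices S ∣ < ∣ O G x r ∣
      ∣forbidden∣<∣O∣ = ≤-trans (s≤s (≤-trans (∣p∪q∣≤∣p∣+∣q∣ (F - x) (legVertices S))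
                                             (+-monoʳ-≤ ∣ F - x ∣ (∣legVertices∣≤2s S))))
                                (≤-trans bound ∣O∣≥i)
    ... | P , P∉forbidden with avoids-∪ P P∉forbidden
    ...   | P∉F-x , P∉legs =
      addLeg P S P∉legs , addLeg-disjoint P S P∉legs (disjoint-⊆ S (p─q⊆p F ⁅ x ⁆) S∩F=∅) P∉F-x

f+2s<2[1+f+s]∸1 : (f s : ℕ) → f + 2 * s < 2 * suc (f + s) ∸ 1
f+2s<2[1+f+s]∸1 f s = ≤-trans (m≤m+n (suc (f + 2 * s)) f) (≤-reflexive
  (solve 2 (λ f s → (con 1 :+ (f :+ con 2 :* s)) :+ f := (f :+ s) :+ (con 1 :+ (f :+ s) :+ con 0)) refl f s))
  where
  open +-*-Solver
  -- the right-hand side is the normal form of 2 * suc (f + s) ∸ 1, which the solver cannot read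

corollary2p2 : (f s ℓ : ℕ) → f + s ≡ ℓ → (G : Digraph) → (r : Fin (n G)) →
    (F : Subset (n G)) → ∣ F ∣ ≡ f → (∀ x → x ∈ F → IsExtender G (2 * ℓ ∸ 1) x r) →
    (S : Spider G s r) → DisjointFrom S F →
    Spider G ℓ r
corollary2p2 zero s .s refl G r F _ _ S _ = S
corollary2p2 (suc f) s .(suc (f + s)) refl G r F ∣F∣≡1+f extenders S S∩F=∅
  with ∣p∣≡1+k⇒nonempty F ∣F∣≡1+f
... | x , x∈F = corollary2p2 f (suc s) _ (+-suc f s) G r (F - x) ∣F-x∣≡f
                  (λ z → extenders z ∘ p─q⊆p F ⁅ x ⁆) (proj₁ step) (proj₂ step)
  where
  ∣F-x∣≡f : ∣ F - x ∣ ≡ f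
  ∣F-x∣≡f = suc-injective (trans (x∈p⇒1+∣p-x∣≡∣p∣ F x x∈F) ∣F∣≡1+f)
  step : Σ[ S′ ∈ Spider G (suc s) r ] DisjointFrom S′ (F - x)
  step = extendSpider x∈F (extenders x x∈F)
           (subst (λ k → k + 2 * s < _) (sym ∣F-x∣≡f) (f+2s<2[1+f+s]∸1 f s)) S S∩F=∅
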